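{- There exists a $3$-uniform hypergraph $H_1$ which has no strongly maximal matching.
   Context: A hypergraph $H$ consists of a (possibly infinite) vertex set $V$ and a set $E$ of edges, each a subset of $V$; it is $3$-uniform if every edge has exactly $3$ vertices. A matching is a set of pairwise disjoint edges. A matching $M$ of $H$ is strongly maximal if for every matching $M'$ of $H$ we have $|M\setminus M'|\geq |M'\setminus M|$ (comparison of cardinalities). -}

module Defs where

open import Data.Bool using (Bool; true; false)
open import Data.Product using (Σ; _×_; _,_)
open import Data.Sum using (_⊎_)
open import Relation.Binary.PropositionalEquality using (_≡_; _≢_)
open import Relation.Nullary using (¬_)

-- Each edge e : E has exactly three (pairwise distinct) vertices; edges are
-- determined by their vertex sets (E is a *set* of 3-subsets of V).
record Hypergraph3 : Set₁ where
  field
    V    : Set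
    E    : Set
    v₁ v₂ v₃ : E → V
    distinct₁₂ : ∀ e → v₁ e ≢ v₂ e
    distinct₁₃ : ∀ e → v₁ e ≢ v₃ e
    distinct₂₃ : ∀ e → v₂ e ≢ v₃ e

  _∈ₑ_ : V → E → Set
  v ∈ₑ e = (v ≡ v₁ e) ⊎ (v ≡ v₂ e) ⊎ (v ≡ v₃ e)

  field
    edge-ext : ∀ e f → (∀ v → (v ∈ₑ e → v ∈ₑ f) × (v ∈ₑ f → v ∈ₑ e)) → e ≡ f

module _ (H : Hypergraph3) where
  open Hypergraph3 H

  EdgeSet : Set
  EdgeSet = E → Bool

  IsMatching : EdgeSet → Set
  IsMatching M = ∀ e f → M e ≡ true → M f ≡ true → e ≢ f →
                 ∀ v → ¬ (v ∈ₑ e × v ∈ₑ f)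

  -- |M \ M'| ≥ |M' \ M| : there is an injection from M' \ M into M \ M'.
  CardGeqDiff : EdgeSet → EdgeSet → Set
  CardGeqDiff M M' =
    Σ ((e : E) → M' e ≡ true → M e ≡ false → E) λ g →
      (∀ e p q → M (g e p q) ≡ true × M' (g e p q) ≡ false) ×
      (∀ e p q e' p' q' → g e p q ≡ g e' p' q' → e ≡ e')

  StronglyMaximal : EdgeSet → Set
  StronglyMaximal M = IsMatching M ×
    (∀ M' → IsMatching M' → CardGeqDiff M M')

-- On level r (the antidiagonal i + d = r) the grid and link edges form a path with r + 1 grid
-- edges, so a matching M has at most r + 1 of them there, and at most r if M uses a hook of that
-- level. If two levels r₁ < r₂ carry hooks of M, taking all grid edges on r₁ and all links on r₂,
-- and moving the hooks of r₁ up to r₂ along their hubs, gains an edge. Otherwise M uses no hook from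
-- some level n on, and taking all links on level n + 1 together with two hooks whose hubs are free
-- gains an edge. Either way the new matching differs from M on finitely many edges, so it beats M.
-- The case split is classical, which is harmless as the conclusion is a negation.

module Submission where

open import Defs
open import Algebra.Properties.CommutativeSemigroup using (interchange)
open import Data.Bool using (Bool; true; false; _∧_; _∨_; not)
open import Data.Bool.Properties using (∧-comm; ¬-not)
open import Data.Empty using (⊥; ⊥-elim)
open import Data.List using (List; []; _∷_; _++_; length)
open import Data.List.Membership.Propositional using (_∈_; _∉_)
open import Data.List.Membership.Propositional.Properties using (∈-++⁺ˡ; ∈-++⁺ʳ; ∈-++⁻)
open import Data.List.Relation.Binary.Disjoint.Propositional using (Disjoint)
open import Data.List.Relation.Unary.All as All using (All; []; _∷_)
open import Data.List.Relation.Unary.AllPairs using ([]; _∷_)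
open import Data.List.Relation.Unary.Any using (here; there; _─_)
open import Data.List.Relation.Unary.Linked as Linked using (Linked; []; [-]; _∷_)
open import Data.List.Relation.Unary.Unique.Propositional using (Unique)
open import Data.List.Relation.Unary.Unique.Propositional.Properties using (++⁺)
open import Data.Nat using (ℕ; zero; suc; _+_; _≤_; _<_; s≤s; z≤n; _≟_; ⌈_/2⌉; _≤ᵇ_)
open import Data.Nat.Properties
  using ( +-assoc; +-comm; +-suc; +-identityʳ; +-cancelˡ-≡; +-cancelʳ-≡; +-commutativeSemigroup
        ; ≤-refl; ≤-reflexive; ≤-trans; ≤-pred; <-irrefl; <⇒≤; n≤1+n; n<1+n; m≤m+n; m<n⇒m<1+n
        ; +-mono-≤; +-monoˡ-≤; +-monoʳ-≤; m≢1+m+n; m≤n⇒∃[o]m+o≡n; module ≤-Reasoning )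
open import Data.Nat.Tactic.RingSolver using (solve-∀)
open import Data.Product using (Σ; _×_; _,_; proj₁; proj₂; uncurry)
open import Data.Sum using (_⊎_; inj₁; inj₂; [_,_])
open import Function using (_∘_; case_of_)
open import Relation.Binary.PropositionalEquality
  using (_≡_; _≢_; refl; sym; trans; cong; cong₂; subst; module ≡-Reasoning)
open import Relation.Nullary using (¬_; yes; no)
open import Relation.Nullary.Decidable using (¬¬-excluded-middle)
open import Relation.Nullary.Negation using (¬¬-map)

toℕ : Bool → ℕ
toℕ false = 0
toℕ true  = 1

toℕ-exclusive : ∀ {a b} → (a ≡ true → b ≡ true → ⊥) → toℕ a + toℕ b ≤ 1
toℕ-exclusive {false} {false} _    = z≤n
toℕ-exclusive {false} {true}  _    = s≤s z≤n
toℕ-exclusive {true}  {false} _    = s≤s z≤n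
toℕ-exclusive {true}  {true}  excl = ⊥-elim (excl refl refl)

toℕ-∨ : ∀ {a b} → (a ≡ true → b ≡ true → ⊥) → toℕ (a ∨ b) ≡ toℕ a + toℕ b
toℕ-∨ {false}        _    = refl
toℕ-∨ {true} {false} _    = refl
toℕ-∨ {true} {true}  excl = ⊥-elim (excl refl refl)

toℕ-split : ∀ a b → toℕ a ≡ toℕ (a ∧ b) + toℕ (a ∧ not b)
toℕ-split false _     = refl
toℕ-split true  false = refl
toℕ-split true  true  = refl

∧-not-true : ∀ {a b} → a ∧ not b ≡ true → a ≡ true × b ≡ false
∧-not-true {true} {false} refl = refl , refl

module _ {A : Set} where

  count : (A → Bool) → List A → ℕ
  count f []       = 0
  count f (x ∷ xs) = toℕ (f x) + count f xs

  count-++ : ∀ f xs ys → count f (xs ++ ys) ≡ count f xs + count f ys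
  count-++ f []       ys = refl
  count-++ f (x ∷ xs) ys =
    trans (cong (toℕ (f x) +_) (count-++ f xs ys)) (sym (+-assoc (toℕ (f x)) _ _))

  count-cong : ∀ {f g : A → Bool} xs → (∀ {x} → x ∈ xs → f x ≡ g x) → count f xs ≡ count g xs
  count-cong []       _  = refl
  count-cong (x ∷ xs) eq = cong₂ _+_ (cong toℕ (eq (here refl))) (count-cong xs (eq ∘ there))

  count-+ : ∀ {f g h : A → Bool} xs → (∀ {x} → x ∈ xs → toℕ (h x) ≡ toℕ (f x) + toℕ (g x)) →
            count h xs ≡ count f xs + count g xs
  count-+ []       _  = refl
  count-+ {f} {g} {h} (x ∷ xs) eq = begin
    toℕ (h x) + count h xs                               ≡⟨ cong₂ _+_ (eq (here refl)) (count-+ xs (eq ∘ there)) ⟩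
    (toℕ (f x) + toℕ (g x)) + (count f xs + count g xs)  ≡⟨ interchange +-commutativeSemigroup
                                                               (toℕ (f x)) (toℕ (g x)) (count f xs) (count g xs) ⟩
    (toℕ (f x) + count f xs) + (toℕ (g x) + count g xs)  ∎
    where open ≡-Reasoning

  count-─ : ∀ {g : A → Bool} {y ys} (p : y ∈ ys) → g y ≡ true → count g ys ≡ suc (count g (ys ─ p))
  count-─ (here refl) gy rewrite gy = refl
  count-─ {g} (there {x = x} p) gy =
    trans (cong (toℕ (g x) +_) (count-─ p gy)) (+-suc (toℕ (g x)) _)

  Exclusive : (A → Bool) → A → A → Set
  Exclusive f x y = f x ≡ true → f y ≡ true → ⊥

  Linked⇒count≤⌈length/2⌉ : ∀ {f xs} → Linked (Exclusive f) xs → count f xs ≤ ⌈ length xs /2⌉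
  Linked⇒count≤⌈length/2⌉                   []               = z≤n
  Linked⇒count≤⌈length/2⌉ {f} {x ∷ []}      [-]              = toℕ-exclusive {f x} {false} λ _ ()
  Linked⇒count≤⌈length/2⌉ {f} {x ∷ y ∷ xs} (excl ∷ linked) =
    subst (_≤ suc ⌈ length xs /2⌉) (+-assoc (toℕ (f x)) (toℕ (f y)) (count f xs))
      (+-mono-≤ (toℕ-exclusive excl) (Linked⇒count≤⌈length/2⌉ (Linked.tail linked)))

  ∈-─⁺ : ∀ {x y} {ys : List A} (p : x ∈ ys) → y ∈ ys → y ≢ x → y ∈ (ys ─ p)
  ∈-─⁺ (here refl) (here refl) y≢x = ⊥-elim (y≢x refl)
  ∈-─⁺ (here refl) (there q)   _   = q
  ∈-─⁺ (there p)   (here refl) _   = here refl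
  ∈-─⁺ (there p)   (there q)   y≢x = there (∈-─⁺ p q y≢x)

  count-≤-injection : ∀ {f g : A → Bool} {xs ys} → Unique xs →
    (φ : ∀ {x} → x ∈ xs → f x ≡ true → A) →
    (∀ {x} (p : x ∈ xs) fx → φ p fx ∈ ys × g (φ p fx) ≡ true) →
    (∀ {x y} (p : x ∈ xs) (q : y ∈ xs) fx fy → φ p fx ≡ φ q fy → x ≡ y) →
    count f xs ≤ count g ys
  count-≤-injection {xs = []} _ _ _ _ = z≤n
  count-≤-injection {f} {g} {x ∷ xs} {ys} (x∉xs ∷ xs!) φ φ-into φ-inj with f x in fx
  ... | false = count-≤-injection xs! (φ ∘ there) (φ-into ∘ there) (λ p q → φ-inj (there p) (there q))
  ... | true  = begin
    suc (count f xs)            ≤⟨ s≤s (count-≤-injection xs! (φ ∘ there) φ-into-rest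
                                                           (λ p q → φ-inj (there p) (there q))) ⟩
    suc (count g (ys ─ φx∈ys))  ≡⟨ count-─ φx∈ys (proj₂ (φ-into (here refl) fx)) ⟨
    count g ys                  ∎
    where
    open ≤-Reasoning
    φx∈ys = proj₁ (φ-into (here refl) fx)
    φ-into-rest : ∀ {y} (q : y ∈ xs) fy → φ (there q) fy ∈ (ys ─ φx∈ys) × g (φ (there q) fy) ≡ true
    φ-into-rest q fy =
      ∈-─⁺ φx∈ys (proj₁ (φ-into (there q) fy))
        (λ eq → All.lookup x∉xs q (sym (φ-inj (there q) (here refl) fy fx eq))) ,
      proj₂ (φ-into (there q) fy)

module _ (H : Hypergraph3) where
  open Hypergraph3 H

  count<⇒¬CardGeqDiff : ∀ (M M′ : EdgeSet H) (L : List E) → Unique L →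
    (∀ e → M e ≢ M′ e → e ∈ L) → count M L < count M′ L → ¬ CardGeqDiff H M M′
  count<⇒¬CardGeqDiff M M′ L L! differ-in-L M<M′ (g , g-lost , g-inj) =
    <-irrefl refl (≤-trans M<M′ M′≤M)
    where
    gained lost : E → Bool
    gained e = M′ e ∧ not (M e)
    lost   e = M e ∧ not (M′ e)

    φ : ∀ {e} → e ∈ L → gained e ≡ true → E
    φ {e} _ ge = g e (proj₁ (∧-not-true ge)) (proj₂ (∧-not-true ge))

    φ-into : ∀ {e} (p : e ∈ L) ge → φ p ge ∈ L × lost (φ p ge) ≡ true
    φ-into {e} p ge with g-lost e (proj₁ (∧-not-true ge)) (proj₂ (∧-not-true ge))
    ... | in-M , not-in-M′ =
      differ-in-L _ (λ eq → case trans (sym in-M) (trans eq not-in-M′) of λ ()) ,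
      cong₂ (λ a b → a ∧ not b) in-M not-in-M′

    M′≤M : count M′ L ≤ count M L
    M′≤M = begin
      count M′ L                                   ≡⟨ count-+ L (λ {e} _ → toℕ-split (M′ e) (M e)) ⟩
      count (λ e → M′ e ∧ M e) L + count gained L  ≤⟨ +-mono-≤ (≤-reflexive common) gained≤lost ⟩
      count (λ e → M e ∧ M′ e) L + count lost L    ≡⟨ count-+ L (λ {e} _ → toℕ-split (M e) (M′ e)) ⟨
      count M L                                    ∎
      where
      open ≤-Reasoning
      common : count (λ e → M′ e ∧ M e) L ≡ count (λ e → M e ∧ M′ e) L
      common = count-cong L λ {e} _ → ∧-comm (M′ e) (M e)
      gained≤lost : count gained L ≤ count lost L
      gained≤lost = count-≤-injection L! φ φ-into λ _ _ _ _ → g-inj _ _ _ _ _ _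

data Vertex : Set where
  hub       : ℕ → Vertex
  π ρ s t w : ℕ → ℕ → Vertex

data Edge : Set where
  grid link hook : ℕ → ℕ → Edge

-- The grid edges sit at the points (i , d) of ℕ². On the antidiagonal i + d = r they alternate
-- with link edges in the path grid i (suc d) , link i d , grid (suc i) d , … ; the hook
-- edge hook k e meets grid k e, and all hooks with the same k share the vertex hub k.
v₁ v₂ v₃ : Edge → Vertex
v₁ (grid i d) = π i d
v₁ (link i d) = t i (suc d)
v₁ (hook k e) = hub k
v₂ (grid i d) = s i d
v₂ (link i d) = s (suc i) d
v₂ (hook k e) = π k e
v₃ (grid i d) = t i d
v₃ (link i d) = w i d
v₃ (hook k e) = ρ k e

_∈ᵥ_ : Vertex → Edge → Set
v ∈ᵥ f = (v ≡ v₁ f) ⊎ (v ≡ v₂ f) ⊎ (v ≡ v₃ f)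

hub-∈ : ∀ {k f} → hub k ∈ᵥ f → Σ ℕ λ e → f ≡ hook k e
hub-∈ {f = grid i d} (inj₁ ())
hub-∈ {f = grid i d} (inj₂ (inj₁ ()))
hub-∈ {f = grid i d} (inj₂ (inj₂ ()))
hub-∈ {f = link i d} (inj₁ ())
hub-∈ {f = link i d} (inj₂ (inj₁ ()))
hub-∈ {f = link i d} (inj₂ (inj₂ ()))
hub-∈ {f = hook k e} (inj₁ refl) = e , refl
hub-∈ {f = hook k e} (inj₂ (inj₁ ()))
hub-∈ {f = hook k e} (inj₂ (inj₂ ()))

π-∈ : ∀ {i d f} → π i d ∈ᵥ f → f ≡ grid i d ⊎ f ≡ hook i d
π-∈ {f = grid i d} (inj₁ refl) = inj₁ refl
π-∈ {f = grid i d} (inj₂ (inj₁ ()))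
π-∈ {f = grid i d} (inj₂ (inj₂ ()))
π-∈ {f = link i d} (inj₁ ())
π-∈ {f = link i d} (inj₂ (inj₁ ()))
π-∈ {f = link i d} (inj₂ (inj₂ ()))
π-∈ {f = hook k e} (inj₁ ())
π-∈ {f = hook k e} (inj₂ (inj₁ refl)) = inj₂ refl
π-∈ {f = hook k e} (inj₂ (inj₂ ()))

ρ-∈ : ∀ {k e f} → ρ k e ∈ᵥ f → f ≡ hook k e
ρ-∈ {f = grid i d} (inj₁ ())
ρ-∈ {f = grid i d} (inj₂ (inj₁ ()))
ρ-∈ {f = grid i d} (inj₂ (inj₂ ()))
ρ-∈ {f = link i d} (inj₁ ())
ρ-∈ {f = link i d} (inj₂ (inj₁ ()))
ρ-∈ {f = link i d} (inj₂ (inj₂ ()))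
ρ-∈ {f = hook k e} (inj₁ ())
ρ-∈ {f = hook k e} (inj₂ (inj₁ ()))
ρ-∈ {f = hook k e} (inj₂ (inj₂ refl)) = refl

w-∈ : ∀ {i d f} → w i d ∈ᵥ f → f ≡ link i d
w-∈ {f = grid i d} (inj₁ ())
w-∈ {f = grid i d} (inj₂ (inj₁ ()))
w-∈ {f = grid i d} (inj₂ (inj₂ ()))
w-∈ {f = link i d} (inj₁ ())
w-∈ {f = link i d} (inj₂ (inj₁ ()))
w-∈ {f = link i d} (inj₂ (inj₂ refl)) = refl
w-∈ {f = hook k e} (inj₁ ())
w-∈ {f = hook k e} (inj₂ (inj₁ ()))
w-∈ {f = hook k e} (inj₂ (inj₂ ()))

s-∈ : ∀ {i d f} → s i d ∈ᵥ f → f ≡ grid i d ⊎ Σ ℕ λ i′ → i ≡ suc i′ × f ≡ link i′ d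
s-∈ {f = grid i d} (inj₁ ())
s-∈ {f = grid i d} (inj₂ (inj₁ refl)) = inj₁ refl
s-∈ {f = grid i d} (inj₂ (inj₂ ()))
s-∈ {f = link i d} (inj₁ ())
s-∈ {f = link i d} (inj₂ (inj₁ refl)) = inj₂ (i , refl , refl)
s-∈ {f = link i d} (inj₂ (inj₂ ()))
s-∈ {f = hook k e} (inj₁ ())
s-∈ {f = hook k e} (inj₂ (inj₁ ()))
s-∈ {f = hook k e} (inj₂ (inj₂ ()))

t-∈ : ∀ {i d f} → t i d ∈ᵥ f → f ≡ grid i d ⊎ Σ ℕ λ d′ → d ≡ suc d′ × f ≡ link i d′
t-∈ {f = grid i d} (inj₁ ())
t-∈ {f = grid i d} (inj₂ (inj₁ ()))
t-∈ {f = grid i d} (inj₂ (inj₂ refl)) = inj₁ refl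
t-∈ {f = link i d} (inj₁ refl) = inj₂ (d , refl , refl)
t-∈ {f = link i d} (inj₂ (inj₁ ()))
t-∈ {f = link i d} (inj₂ (inj₂ ()))
t-∈ {f = hook k e} (inj₁ ())
t-∈ {f = hook k e} (inj₂ (inj₁ ()))
t-∈ {f = hook k e} (inj₂ (inj₂ ()))

edges-determined-by-vertices : ∀ e f → (∀ v → (v ∈ᵥ e → v ∈ᵥ f) × (v ∈ᵥ f → v ∈ᵥ e)) → e ≡ f
edges-determined-by-vertices (grid i d) f same with π-∈ (proj₁ (same (π i d)) (inj₁ refl))
... | inj₁ refl = refl
... | inj₂ refl with s-∈ {i} {d} (proj₁ (same (s i d)) (inj₂ (inj₁ refl)))
...   | inj₁ ()
...   | inj₂ (_ , _ , ())
edges-determined-by-vertices (link i d) f same = sym (w-∈ (proj₁ (same (w i d)) (inj₂ (inj₂ refl))))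
edges-determined-by-vertices (hook k e) f same = sym (ρ-∈ (proj₁ (same (ρ k e)) (inj₂ (inj₂ refl))))

H₁ : Hypergraph3
H₁ = record
  { V = Vertex ; E = Edge ; v₁ = v₁ ; v₂ = v₂ ; v₃ = v₃
  ; distinct₁₂ = λ { (grid _ _) () ; (link _ _) () ; (hook _ _) () }
  ; distinct₁₃ = λ { (grid _ _) () ; (link _ _) () ; (hook _ _) () }
  ; distinct₂₃ = λ { (grid _ _) () ; (link _ _) () ; (hook _ _) () }
  ; edge-ext = edges-determined-by-vertices
  }

record NoConflicts (M : EdgeSet H₁) : Set where
  field
    grid-hook  : ∀ i d → M (grid i d) ≡ true → M (hook i d) ≡ true → ⊥
    grid-linkˢ : ∀ i d → M (grid (suc i) d) ≡ true → M (link i d) ≡ true → ⊥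
    grid-linkᵗ : ∀ i d → M (grid i (suc d)) ≡ true → M (link i d) ≡ true → ⊥
    hook-hook  : ∀ k e e′ → M (hook k e) ≡ true → M (hook k e′) ≡ true → e ≡ e′

isMatching⇒noConflicts : ∀ M → IsMatching H₁ M → NoConflicts M
isMatching⇒noConflicts M disjoint = record
  { grid-hook  = λ i d a b → disjoint _ _ a b (λ ()) (π i d) (inj₁ refl , inj₂ (inj₁ refl))
  ; grid-linkˢ = λ i d a b → disjoint _ _ a b (λ ()) (s (suc i) d) (inj₂ (inj₁ refl) , inj₂ (inj₁ refl))
  ; grid-linkᵗ = λ i d a b → disjoint _ _ a b (λ ()) (t i (suc d)) (inj₂ (inj₂ refl) , inj₁ refl)
  ; hook-hook  = hook-hook
  }
  where
  hook-hook : ∀ k e e′ → M (hook k e) ≡ true → M (hook k e′) ≡ true → e ≡ e′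
  hook-hook k e e′ a b with e ≟ e′
  ... | yes e≡e′ = e≡e′
  ... | no e≢e′ = ⊥-elim (disjoint _ _ a b (λ { refl → e≢e′ refl }) (hub k) (inj₁ refl , inj₁ refl))

noConflicts⇒isMatching : ∀ M → NoConflicts M → IsMatching H₁ M
noConflicts⇒isMatching M nc = disjoint
  where
  open NoConflicts nc
  disjoint : IsMatching H₁ M
  disjoint (grid i d) f a b e≢f _ (inj₁ refl , v∈f) with π-∈ {i} {d} {f} v∈f
  ... | inj₁ refl = e≢f refl
  ... | inj₂ refl = grid-hook i d a b
  disjoint (grid i d) f a b e≢f _ (inj₂ (inj₁ refl) , v∈f) with s-∈ {i} {d} {f} v∈f
  ... | inj₁ refl = e≢f refl
  ... | inj₂ (i′ , refl , refl) = grid-linkˢ i′ d a b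
  disjoint (grid i d) f a b e≢f _ (inj₂ (inj₂ refl) , v∈f) with t-∈ {i} {d} {f} v∈f
  ... | inj₁ refl = e≢f refl
  ... | inj₂ (d′ , refl , refl) = grid-linkᵗ i d′ a b
  disjoint (link i d) f a b e≢f _ (inj₁ refl , v∈f) with t-∈ {i} {suc d} {f} v∈f
  ... | inj₁ refl = grid-linkᵗ i d b a
  ... | inj₂ (_ , refl , refl) = e≢f refl
  disjoint (link i d) f a b e≢f _ (inj₂ (inj₁ refl) , v∈f) with s-∈ {suc i} {d} {f} v∈f
  ... | inj₁ refl = grid-linkˢ i d b a
  ... | inj₂ (_ , refl , refl) = e≢f refl
  disjoint (link i d) f a b e≢f _ (inj₂ (inj₂ refl) , v∈f) with w-∈ {i} {d} {f} v∈f
  ... | refl = e≢f refl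
  disjoint (hook k e) f a b e≢f _ (inj₁ refl , v∈f) with hub-∈ {k} {f} v∈f
  ... | e′ , refl with hook-hook k e e′ a b
  ...   | refl = e≢f refl
  disjoint (hook k e) f a b e≢f _ (inj₂ (inj₁ refl) , v∈f) with π-∈ {k} {e} {f} v∈f
  ... | inj₁ refl = grid-hook k e b a
  ... | inj₂ refl = e≢f refl
  disjoint (hook k e) f a b e≢f _ (inj₂ (inj₂ refl) , v∈f) with ρ-∈ {k} {e} {f} v∈f
  ... | refl = e≢f refl

level column : Edge → ℕ
level (grid i d) = i + d
level (link i d) = i + suc d
level (hook k e) = k + e
column (grid i _) = i
column (link i _) = i
column (hook k _) = k

path : ℕ → ℕ → List Edge
path i zero    = grid i zero ∷ []
path i (suc d) = grid i (suc d) ∷ link i d ∷ path (suc i) d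

hooks : ℕ → ℕ → List Edge
hooks i zero    = hook i zero ∷ []
hooks i (suc d) = hook i (suc d) ∷ hooks (suc i) d

antidiagonal : ℕ → List Edge
antidiagonal r = path 0 r ++ hooks 0 r

∈-path⁻ : ∀ {x} i d → x ∈ path i d → i ≤ column x × level x ≡ i + d
∈-path⁻ i zero    (here refl)         = ≤-refl , refl
∈-path⁻ i (suc d) (here refl)         = ≤-refl , refl
∈-path⁻ i (suc d) (there (here refl)) = ≤-refl , refl
∈-path⁻ i (suc d) (there (there x∈)) with ∈-path⁻ (suc i) d x∈
... | i<column , level≡ = <⇒≤ i<column , trans level≡ (sym (+-suc i d))

∈-hooks⁻ : ∀ {x} i d → x ∈ hooks i d → Σ ℕ λ k → Σ ℕ λ e → x ≡ hook k e × i ≤ k × k + e ≡ i + d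
∈-hooks⁻ i zero    (here refl) = i , zero , refl , ≤-refl , refl
∈-hooks⁻ i (suc d) (here refl) = i , suc d , refl , ≤-refl , refl
∈-hooks⁻ i (suc d) (there x∈) with ∈-hooks⁻ (suc i) d x∈
... | k , e , refl , i<k , level≡ = k , e , refl , <⇒≤ i<k , trans level≡ (sym (+-suc i d))

hook∉path : ∀ {k e} i d → hook k e ∉ path i d
hook∉path i zero    (here ())
hook∉path i zero    (there ())
hook∉path i (suc d) (here ())
hook∉path i (suc d) (there (here ()))
hook∉path i (suc d) (there (there p)) = hook∉path (suc i) d p

∈-antidiagonal⁻ : ∀ {x} r → x ∈ antidiagonal r → level x ≡ r
∈-antidiagonal⁻ r x∈ with ∈-++⁻ (path 0 r) x∈
... | inj₁ x∈path  = proj₂ (∈-path⁻ 0 r x∈path)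
... | inj₂ x∈hooks with ∈-hooks⁻ 0 r x∈hooks
...   | _ , _ , refl , _ , level≡ = level≡

grid-∈-path : ∀ j i e → grid (j + i) e ∈ path i (j + e)
grid-∈-path zero i zero    = here refl
grid-∈-path zero i (suc e) = here refl
grid-∈-path (suc j) i e    =
  there (there (subst (λ c → grid c e ∈ path (suc i) (j + e)) (+-suc j i) (grid-∈-path j (suc i) e)))

link-∈-path : ∀ j i e → link (j + i) e ∈ path i (j + suc e)
link-∈-path zero i e    = there (here refl)
link-∈-path (suc j) i e =
  there (there (subst (λ c → link c e ∈ path (suc i) (j + suc e)) (+-suc j i) (link-∈-path j (suc i) e)))

hook-∈-hooks : ∀ j i e → hook (j + i) e ∈ hooks i (j + e)
hook-∈-hooks zero i zero    = here refl
hook-∈-hooks zero i (suc e) = here refl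
hook-∈-hooks (suc j) i e    =
  there (subst (λ c → hook c e ∈ hooks (suc i) (j + e)) (+-suc j i) (hook-∈-hooks j (suc i) e))

grid-∈-path₀ : ∀ i d → grid i d ∈ path 0 (i + d)
grid-∈-path₀ i d = subst (λ c → grid c d ∈ path 0 (i + d)) (+-identityʳ i) (grid-∈-path i 0 d)

∈-antidiagonal⁺ : ∀ x → x ∈ antidiagonal (level x)
∈-antidiagonal⁺ (grid i d) = ∈-++⁺ˡ (grid-∈-path₀ i d)
∈-antidiagonal⁺ (link i d) =
  ∈-++⁺ˡ (subst (λ c → link c d ∈ path 0 (i + suc d)) (+-identityʳ i) (link-∈-path i 0 d))
∈-antidiagonal⁺ (hook k e) =
  ∈-++⁺ʳ (path 0 (k + e)) (subst (λ c → hook c e ∈ hooks 0 (k + e)) (+-identityʳ k) (hook-∈-hooks k 0 e))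

fresh-by-column : ∀ {x ys} → (∀ {y} → y ∈ ys → suc (column x) ≤ column y) → All (x ≢_) ys
fresh-by-column later = All.tabulate λ { y∈ refl → <-irrefl refl (later y∈) }

path-unique : ∀ i d → Unique (path i d)
path-unique i zero    = [] ∷ []
path-unique i (suc d) =
  ((λ ()) ∷ fresh-by-column (proj₁ ∘ ∈-path⁻ (suc i) d)) ∷
  fresh-by-column (proj₁ ∘ ∈-path⁻ (suc i) d) ∷
  path-unique (suc i) d

hooks-unique : ∀ i d → Unique (hooks i d)
hooks-unique i zero    = [] ∷ []
hooks-unique i (suc d) = fresh-by-column later ∷ hooks-unique (suc i) d
  where
  later : ∀ {y} → y ∈ hooks (suc i) d → suc i ≤ column y
  later y∈ with ∈-hooks⁻ (suc i) d y∈
  ... | _ , _ , refl , i<k , _ = i<k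

antidiagonal-unique : ∀ r → Unique (antidiagonal r)
antidiagonal-unique r = ++⁺ (path-unique 0 r) (hooks-unique 0 r) disjoint
  where
  disjoint : Disjoint (path 0 r) (hooks 0 r)
  disjoint (x∈path , x∈hooks) with ∈-hooks⁻ 0 r x∈hooks
  ... | _ , _ , refl , _ = hook∉path 0 r x∈path

antidiagonals-unique : ∀ {r r′} → r ≢ r′ → Unique (antidiagonal r ++ antidiagonal r′)
antidiagonals-unique {r} {r′} r≢r′ = ++⁺ (antidiagonal-unique r) (antidiagonal-unique r′)
  λ (x∈r , x∈r′) → r≢r′ (trans (sym (∈-antidiagonal⁻ r x∈r)) (∈-antidiagonal⁻ r′ x∈r′))

Active : EdgeSet H₁ → ℕ → Set
Active M r = Σ ℕ λ k → Σ ℕ λ e → k + e ≡ r × M (hook k e) ≡ true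

module AntidiagonalBounds {M : EdgeSet H₁} (nc : NoConflicts M) where
  open NoConflicts nc

  path-linked      : ∀ i d → Linked (Exclusive M) (path i d)
  link-path-linked : ∀ i d → Linked (Exclusive M) (link i d ∷ path (suc i) d)
  path-linked i zero    = [-]
  path-linked i (suc d) = grid-linkᵗ i d ∷ link-path-linked i d
  link-path-linked i zero    = (λ l g → grid-linkˢ i zero g l) ∷ path-linked (suc i) zero
  link-path-linked i (suc d) = (λ l g → grid-linkˢ i (suc d) g l) ∷ path-linked (suc i) (suc d)

  ⌈length-path/2⌉ : ∀ i d → ⌈ length (path i d) /2⌉ ≡ suc d
  ⌈length-path/2⌉ i zero    = refl
  ⌈length-path/2⌉ i (suc d) = cong suc (⌈length-path/2⌉ (suc i) d)

  ⌈length-link-path/2⌉ : ∀ i d → ⌈ length (link i d ∷ path (suc i) d) /2⌉ ≡ suc d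
  ⌈length-link-path/2⌉ i zero    = refl
  ⌈length-link-path/2⌉ i (suc d) = cong suc (⌈length-link-path/2⌉ (suc i) d)

  link-path-count-≤ : ∀ i d → count M (link i d ∷ path (suc i) d) ≤ suc d
  link-path-count-≤ i d =
    subst (count M (link i d ∷ path (suc i) d) ≤_) (⌈length-link-path/2⌉ i d)
      (Linked⇒count≤⌈length/2⌉ (link-path-linked i d))

  path-count-≤ : ∀ i d → count M (path i d) ≤ suc d
  path-count-≤ i d =
    subst (count M (path i d) ≤_) (⌈length-path/2⌉ i d) (Linked⇒count≤⌈length/2⌉ (path-linked i d))

  path-count-≤-with-gap : ∀ {k e} i d → grid k e ∈ path i d → M (grid k e) ≡ false →
                          count M (path i d) ≤ d
  path-count-≤-with-gap i zero    (here refl) off rewrite off = z≤n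
  path-count-≤-with-gap i (suc d) (here refl) off rewrite off = link-path-count-≤ i d
  path-count-≤-with-gap i (suc d) (there (there g∈)) off =
    subst (_≤ suc d) (+-assoc (toℕ (M (grid i (suc d)))) (toℕ (M (link i d))) _)
      (+-mono-≤ (toℕ-exclusive (grid-linkᵗ i d)) (path-count-≤-with-gap (suc i) d g∈ off))

  antidiagonal-count-≤ : ∀ r → count M (antidiagonal r) ≤ suc r + count M (hooks 0 r)
  antidiagonal-count-≤ r = begin
    count M (antidiagonal r)                    ≡⟨ count-++ M (path 0 r) _ ⟩
    count M (path 0 r) + count M (hooks 0 r)    ≤⟨ +-monoˡ-≤ _ (path-count-≤ 0 r) ⟩
    suc r + count M (hooks 0 r)                 ∎
    where open ≤-Reasoning

  active-antidiagonal-count-≤ : ∀ {r} → Active M r → count M (antidiagonal r) ≤ r + count M (hooks 0 r)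
  active-antidiagonal-count-≤ {r} (k , e , refl , chosen) = begin
    count M (antidiagonal r)                    ≡⟨ count-++ M (path 0 r) _ ⟩
    count M (path 0 r) + count M (hooks 0 r)    ≤⟨ +-monoˡ-≤ _ (path-count-≤-with-gap 0 r (grid-∈-path₀ k e) grid-off) ⟩
    r + count M (hooks 0 r)                     ∎
    where
    open ≤-Reasoning
    grid-off : M (grid k e) ≡ false
    grid-off = ¬-not (λ on → grid-hook k e on chosen)

data Move : Set where
  keep allGrid allLinks : Move

hookSet : (ℕ → ℕ → Bool) → EdgeSet H₁
hookSet f (hook k e) = f k e
hookSet f _          = false

module Rearrangement
  (M : EdgeSet H₁) (nc : NoConflicts M) (move : ℕ → Move) (extra : ℕ → ℕ → Bool)
  (allLinks-unique : ∀ {r r′} → move r ≡ allLinks → move r′ ≡ allLinks → r ≡ r′)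
  (extra-hub-free : ∀ {k e e′} → move (k + e) ≡ allLinks → extra k e ≡ true →
                    M (hook k e′) ≡ true → move (k + e′) ≡ keep → ⊥)
  where
  open NoConflicts nc

  apply : Move → EdgeSet H₁
  apply keep     x          = M x
  apply allGrid  (grid _ _) = true
  apply allGrid  (link _ _) = false
  apply allGrid  (hook _ _) = false
  apply allLinks (grid _ _) = false
  apply allLinks (link _ _) = true
  apply allLinks (hook k e) = M (hook k e) ∨ extra k e

  M′ : EdgeSet H₁
  M′ x = apply (move (level x)) x

  M′-keep : ∀ x → move (level x) ≡ keep → M′ x ≡ M x
  M′-keep x kept rewrite kept = refl

  private
    grid-hook-apply : ∀ m {i d k e} → apply m (grid i d) ≡ true → apply m (hook k e) ≡ true →
                      M (grid i d) ≡ true × M (hook k e) ≡ true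
    grid-hook-apply keep     g h = g , h
    grid-hook-apply allGrid  _ ()
    grid-hook-apply allLinks () _

    grid-link-apply : ∀ m {i d j e} → apply m (grid i d) ≡ true → apply m (link j e) ≡ true →
                      M (grid i d) ≡ true × M (link j e) ≡ true
    grid-link-apply keep     g l = g , l
    grid-link-apply allGrid  _ ()
    grid-link-apply allLinks () _

    link-level : ∀ i d → M′ (link i d) ≡ apply (move (suc (i + d))) (link i d)
    link-level i d = cong (λ r → apply (move r) (link i d)) (+-suc i d)

    hook-hook′ : ∀ k e e′ → M′ (hook k e) ≡ true → M′ (hook k e′) ≡ true → e ≡ e′
    hook-hook′ k e e′ a b with move (k + e) in m | move (k + e′) in m′
    ... | keep     | keep     = hook-hook k e e′ a b
    ... | allLinks | allLinks = +-cancelˡ-≡ k e e′ (allLinks-unique m m′)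
    ... | allLinks | keep with M (hook k e) in chosen
    ...   | true  = hook-hook k e e′ chosen b
    ...   | false = ⊥-elim (extra-hub-free m a b m′)
    hook-hook′ k e e′ a b | keep | allLinks with M (hook k e′) in chosen
    ...   | true  = hook-hook k e e′ a chosen
    ...   | false = ⊥-elim (extra-hub-free m′ b a m)

  M′-noConflicts : NoConflicts M′
  M′-noConflicts = record
    { grid-hook  = λ i d g h → uncurry (grid-hook i d) (grid-hook-apply (move (i + d)) g h)
    ; grid-linkˢ = λ i d g l →
        uncurry (grid-linkˢ i d) (grid-link-apply (move (suc (i + d))) g (trans (sym (link-level i d)) l))
    ; grid-linkᵗ = λ i d g l → uncurry (grid-linkᵗ i d) (grid-link-apply (move (i + suc d)) g l)
    ; hook-hook  = hook-hook′
    }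

  count-M′-antidiagonal : ∀ {r m} → move r ≡ m →
                          count M′ (antidiagonal r) ≡ count (apply m) (path 0 r) + count (apply m) (hooks 0 r)
  count-M′-antidiagonal {r} refl =
    trans (count-cong (antidiagonal r) λ {x} x∈ → cong (λ r → apply (move r) x) (∈-antidiagonal⁻ r x∈))
          (count-++ (apply (move r)) (path 0 r) (hooks 0 r))

  allGrid-path : ∀ i d → count (apply allGrid) (path i d) ≡ suc d
  allGrid-path i zero    = refl
  allGrid-path i (suc d) = cong suc (allGrid-path (suc i) d)

  allGrid-hooks : ∀ i d → count (apply allGrid) (hooks i d) ≡ 0
  allGrid-hooks i zero    = refl
  allGrid-hooks i (suc d) = allGrid-hooks (suc i) d

  allLinks-path : ∀ i d → count (apply allLinks) (path i d) ≡ d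
  allLinks-path i zero    = refl
  allLinks-path i (suc d) = cong suc (allLinks-path (suc i) d)

  allGrid-count : ∀ {r} → move r ≡ allGrid → count M′ (antidiagonal r) ≡ suc r
  allGrid-count {r} m = begin
    count M′ (antidiagonal r)                                             ≡⟨ count-M′-antidiagonal m ⟩
    count (apply allGrid) (path 0 r) + count (apply allGrid) (hooks 0 r)  ≡⟨ cong₂ _+_ (allGrid-path 0 r) (allGrid-hooks 0 r) ⟩
    suc r + 0                                                             ≡⟨ +-identityʳ (suc r) ⟩
    suc r                                                                 ∎
    where open ≡-Reasoning

  allLinks-count : ∀ {r} → move r ≡ allLinks →
    (∀ {k e} → k + e ≡ r → M (hook k e) ≡ true → extra k e ≡ true → ⊥) →
    count M′ (antidiagonal r) ≡ r + (count M (hooks 0 r) + count (hookSet extra) (hooks 0 r))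
  allLinks-count {r} m extra-unchosen = begin
    count M′ (antidiagonal r)                                               ≡⟨ count-M′-antidiagonal m ⟩
    count (apply allLinks) (path 0 r) + count (apply allLinks) (hooks 0 r)  ≡⟨ cong₂ _+_ (allLinks-path 0 r)
                                                                                         (count-+ (hooks 0 r) toℕ-hook) ⟩
    r + (count M (hooks 0 r) + count (hookSet extra) (hooks 0 r))           ∎
    where
    open ≡-Reasoning
    toℕ-hook : ∀ {x} → x ∈ hooks 0 r → toℕ (apply allLinks x) ≡ toℕ (M x) + toℕ (hookSet extra x)
    toℕ-hook x∈ with ∈-hooks⁻ 0 r x∈
    ... | k , e , refl , _ , level≡ = toℕ-∨ (extra-unchosen level≡)

record Improvement (M : EdgeSet H₁) : Set where
  field
    M′                : EdgeSet H₁
    M′-noConflicts    : NoConflicts M′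
    support           : List Edge
    support-unique    : Unique support
    differ-in-support : ∀ x → M x ≢ M′ x → x ∈ support
    gain              : count M support < count M′ support

improvement⇒¬stronglyMaximal : ∀ {M} → Improvement M → ¬ StronglyMaximal H₁ M
improvement⇒¬stronglyMaximal {M} imp (_ , larger-than-all) =
  count<⇒¬CardGeqDiff H₁ M M′ support support-unique differ-in-support gain
    (larger-than-all M′ (noConflicts⇒isMatching M′ M′-noConflicts))
  where open Improvement imp

delay : ℕ → (ℕ → Bool) → ℕ → Bool
delay zero    f e       = f e
delay (suc g) f zero    = false
delay (suc g) f (suc e) = delay g f e

delay-+ : ∀ g f e → delay g f (e + g) ≡ f e
delay-+ zero    f e = cong f (+-identityʳ e)
delay-+ (suc g) f e rewrite +-suc e g = delay-+ g f e

delay-< : ∀ {g f e} → e < g → delay g f e ≡ false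
delay-< {suc g} {e = zero}  _          = refl
delay-< {suc g} {e = suc e} (s≤s e<g) = delay-< e<g

delay-true : ∀ g {f e} → delay g f e ≡ true → Σ ℕ λ e′ → e ≡ e′ + g × f e′ ≡ true
delay-true zero    {e = e}     on = e , sym (+-identityʳ e) , on
delay-true (suc g) {e = suc e} on with delay-true g on
... | e′ , refl , on′ = e′ , sym (+-suc e′ g) , on′

delayedHooks : ℕ → EdgeSet H₁ → EdgeSet H₁
delayedHooks g M = hookSet λ k → delay g λ e → M (hook k e)

delayedHooks-early : ∀ {g} M i d → d < g → count (delayedHooks g M) (hooks i d) ≡ 0
delayedHooks-early M i zero    (s≤s _)   = refl
delayedHooks-early {suc g} M i (suc d) (s≤s d<g) rewrite delay-< {g} {λ e → M (hook i e)} {d} d<g =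
  delayedHooks-early M (suc i) d (m<n⇒m<1+n d<g)

delayedHooks-shift : ∀ g M i d → count (delayedHooks (suc g) M) (hooks i (d + suc g)) ≡ count M (hooks i d)
delayedHooks-shift g M i zero =
  cong₂ _+_ (cong toℕ (delay-+ (suc g) (λ e → M (hook i e)) zero)) (delayedHooks-early M (suc i) g ≤-refl)
delayedHooks-shift g M i (suc d) =
  cong₂ _+_ (cong toℕ (delay-+ (suc g) (λ e → M (hook i e)) (suc d))) (delayedHooks-shift g M (suc i) d)

TwoActiveLevels : EdgeSet H₁ → Set
TwoActiveLevels M = Σ ℕ λ r₁ → Σ ℕ λ δ → Active M r₁ × Active M (r₁ + suc δ)

twoActiveLevels⇒improvement : ∀ {M} → NoConflicts M → TwoActiveLevels M → Improvement M
twoActiveLevels⇒improvement {M} nc (r₁ , δ , active₁ , active₂) = record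
  { M′                = M′
  ; M′-noConflicts    = M′-noConflicts
  ; support           = antidiagonal r₁ ++ antidiagonal r₂
  ; support-unique    = antidiagonals-unique r₁≢r₂
  ; differ-in-support = differ-in-support
  ; gain              = gain
  }
  where
  open NoConflicts nc
  r₂ = r₁ + suc δ

  r₁≢r₂ : r₁ ≢ r₂
  r₁≢r₂ eq = m≢1+m+n r₁ (trans eq (+-suc r₁ δ))

  move : ℕ → Move
  move r with r ≟ r₁ | r ≟ r₂
  ... | yes _ | _     = allGrid
  ... | no _  | yes _ = allLinks
  ... | no _  | no _  = keep

  move-r₁ : move r₁ ≡ allGrid
  move-r₁ with r₁ ≟ r₁
  ... | yes _ = refl
  ... | no r₁≢r₁ = ⊥-elim (r₁≢r₁ refl)

  move-allLinks : ∀ {r} → move r ≡ allLinks → r ≡ r₂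
  move-allLinks {r} m with r ≟ r₁ | r ≟ r₂
  move-allLinks () | yes _ | _
  move-allLinks m  | no _  | yes r≡r₂ = r≡r₂
  move-allLinks () | no _  | no _

  move-r₂ : move r₂ ≡ allLinks
  move-r₂ with r₂ ≟ r₁ | r₂ ≟ r₂
  ... | yes r₂≡r₁ | _ = ⊥-elim (r₁≢r₂ (sym r₂≡r₁))
  ... | no _ | yes _ = refl
  ... | no _ | no r₂≢r₂ = ⊥-elim (r₂≢r₂ refl)

  moved-levels : ∀ {r} → move r ≢ keep → r ≡ r₁ ⊎ r ≡ r₂
  moved-levels {r} m with r ≟ r₁ | r ≟ r₂
  ... | yes r≡r₁ | _        = inj₁ r≡r₁
  ... | no _     | yes r≡r₂ = inj₂ r≡r₂
  ... | no _     | no _     = ⊥-elim (m refl)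

  extra : ℕ → ℕ → Bool
  extra k = delay (suc δ) (λ e → M (hook k e))

  extra-source : ∀ {k e} → k + e ≡ r₂ → extra k e ≡ true →
                 Σ ℕ λ e′ → e ≡ e′ + suc δ × k + e′ ≡ r₁ × M (hook k e′) ≡ true
  extra-source {k} {e} level≡ on with delay-true (suc δ) {e = e} on
  ... | e′ , refl , on′ =
    e′ , refl , +-cancelʳ-≡ (suc δ) (k + e′) r₁ (trans (+-assoc k e′ (suc δ)) level≡) , on′

  extra-hub-free : ∀ {k e e′} → move (k + e) ≡ allLinks → extra k e ≡ true →
                   M (hook k e′) ≡ true → move (k + e′) ≡ keep → ⊥
  extra-hub-free {k} {e} {e′} m on chosen kept with extra-source (move-allLinks m) on
  ... | e″ , _ , level≡ , on″ with hook-hook k e″ e′ on″ chosen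
  ... | refl with trans (sym (trans (cong move level≡) move-r₁)) kept
  ... | ()

  extra-unchosen : ∀ {k e} → k + e ≡ r₂ → M (hook k e) ≡ true → extra k e ≡ true → ⊥
  extra-unchosen {k} {e} level≡ chosen on with extra-source level≡ on
  ... | e″ , e≡ , _ , on″ with hook-hook k e e″ chosen on″
  ... | refl = m≢1+m+n e (trans e≡ (+-suc e δ))

  open Rearrangement M nc move extra
         (λ m m′ → trans (move-allLinks m) (sym (move-allLinks m′))) extra-hub-free

  differ-in-support : ∀ x → M x ≢ M′ x → x ∈ antidiagonal r₁ ++ antidiagonal r₂
  differ-in-support x differ with moved-levels (λ kept → differ (sym (M′-keep x kept)))
  ... | inj₁ level≡ = ∈-++⁺ˡ (subst (λ r → x ∈ antidiagonal r) level≡ (∈-antidiagonal⁺ x))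
  ... | inj₂ level≡ =
    ∈-++⁺ʳ (antidiagonal r₁) (subst (λ r → x ∈ antidiagonal r) level≡ (∈-antidiagonal⁺ x))

  h₁ = count M (hooks 0 r₁)
  h₂ = count M (hooks 0 r₂)

  gain : count M (antidiagonal r₁ ++ antidiagonal r₂) < count M′ (antidiagonal r₁ ++ antidiagonal r₂)
  gain = begin-strict
    count M (antidiagonal r₁ ++ antidiagonal r₂)              ≡⟨ count-++ M (antidiagonal r₁) _ ⟩
    count M (antidiagonal r₁) + count M (antidiagonal r₂)     ≤⟨ +-mono-≤ (active-antidiagonal-count-≤ active₁)
                                                                          (active-antidiagonal-count-≤ active₂) ⟩
    (r₁ + h₁) + (r₂ + h₂)                                     <⟨ n<1+n _ ⟩
    suc ((r₁ + h₁) + (r₂ + h₂))                               ≡⟨ rearrange r₁ h₁ r₂ h₂ ⟩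
    suc r₁ + (r₂ + (h₂ + h₁))                                 ≡⟨ cong (λ h → suc r₁ + (r₂ + (h₂ + h)))
                                                                      (delayedHooks-shift δ M 0 r₁) ⟨
    suc r₁ + (r₂ + (h₂ + count (hookSet extra) (hooks 0 r₂))) ≡⟨ cong₂ _+_ (allGrid-count move-r₁)
                                                                          (allLinks-count move-r₂ extra-unchosen) ⟨
    count M′ (antidiagonal r₁) + count M′ (antidiagonal r₂)   ≡⟨ count-++ M′ (antidiagonal r₁) _ ⟨
    count M′ (antidiagonal r₁ ++ antidiagonal r₂)             ∎
    where
    open ≤-Reasoning
    open AntidiagonalBounds nc
    rearrange : ∀ a b c d → suc ((a + b) + (c + d)) ≡ suc a + (c + (d + b))
    rearrange = solve-∀

InactiveFrom : EdgeSet H₁ → ℕ → Set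
InactiveFrom M n = ∀ k e → n ≤ k + e → M (hook k e) ≡ false

inactiveFrom⇒improvement : ∀ {M n} → NoConflicts M → InactiveFrom M n → Improvement M
inactiveFrom⇒improvement {M} {n} nc inactive = record
  { M′                = M′
  ; M′-noConflicts    = M′-noConflicts
  ; support           = antidiagonal (suc n)
  ; support-unique    = antidiagonal-unique (suc n)
  ; differ-in-support = differ-in-support
  ; gain              = gain
  }
  where
  move : ℕ → Move
  move r with r ≟ suc n
  ... | yes _ = allLinks
  ... | no _  = keep

  moved-level : ∀ {r} → move r ≢ keep → r ≡ suc n
  moved-level {r} m with r ≟ suc n
  ... | yes r≡ = r≡
  ... | no _   = ⊥-elim (m refl)

  move-allLinks : ∀ {r} → move r ≡ allLinks → r ≡ suc n
  move-allLinks m = moved-level λ kept → case trans (sym m) kept of λ ()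

  move-suc-n : move (suc n) ≡ allLinks
  move-suc-n with suc n ≟ suc n
  ... | yes _ = refl
  ... | no n≢n = ⊥-elim (n≢n refl)

  extra : ℕ → ℕ → Bool
  extra _ e = e ≤ᵇ 1

  extra-hub : ∀ {k e} → k + e ≡ suc n → extra k e ≡ true → n ≤ k
  extra-hub {k} {e} level≡ on = ≤-pred (begin
    suc n   ≡⟨ level≡ ⟨
    k + e   ≤⟨ +-monoʳ-≤ k (e≤1 e on) ⟩
    k + 1   ≡⟨ +-comm k 1 ⟩
    suc k   ∎)
    where
    open ≤-Reasoning
    e≤1 : ∀ e → (e ≤ᵇ 1) ≡ true → e ≤ 1
    e≤1 zero          _ = z≤n
    e≤1 (suc zero)    _ = s≤s z≤n
    e≤1 (suc (suc _)) ()

  extra-hub-free : ∀ {k e e′} → move (k + e) ≡ allLinks → extra k e ≡ true →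
                   M (hook k e′) ≡ true → move (k + e′) ≡ keep → ⊥
  extra-hub-free {k} {e} {e′} m on chosen _ =
    case trans (sym chosen) (inactive k e′ (≤-trans (extra-hub (move-allLinks m) on) (m≤m+n k e′))) of λ ()

  extra-unchosen : ∀ {k e} → k + e ≡ suc n → M (hook k e) ≡ true → extra k e ≡ true → ⊥
  extra-unchosen {k} {e} level≡ chosen _ =
    case trans (sym chosen) (inactive k e (subst (n ≤_) (sym level≡) (n≤1+n n))) of λ ()

  open Rearrangement M nc move extra
         (λ m m′ → trans (move-allLinks m) (sym (move-allLinks m′))) extra-hub-free

  differ-in-support : ∀ x → M x ≢ M′ x → x ∈ antidiagonal (suc n)
  differ-in-support x differ =
    subst (λ r → x ∈ antidiagonal r) (moved-level λ kept → differ (sym (M′-keep x kept))) (∈-antidiagonal⁺ x)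

  extra-count : ∀ i d → count (hookSet extra) (hooks i (suc d)) ≡ 2
  extra-count i zero    = refl
  extra-count i (suc d) = extra-count (suc i) d

  h = count M (hooks 0 (suc n))

  gain : count M (antidiagonal (suc n)) < count M′ (antidiagonal (suc n))
  gain = begin-strict
    count M (antidiagonal (suc n))                                ≤⟨ antidiagonal-count-≤ (suc n) ⟩
    suc (suc n) + h                                               <⟨ n<1+n _ ⟩
    suc (suc (suc n) + h)                                         ≡⟨ rearrange n h ⟩
    suc n + (h + 2)                                               ≡⟨ cong (λ c → suc n + (h + c)) (extra-count 0 n) ⟨
    suc n + (h + count (hookSet extra) (hooks 0 (suc n)))         ≡⟨ allLinks-count move-suc-n extra-unchosen ⟨
    count M′ (antidiagonal (suc n))                               ∎
    where
    open ≤-Reasoning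
    open AntidiagonalBounds nc
    rearrange : ∀ a b → suc (suc (suc a) + b) ≡ suc a + (b + 2)
    rearrange = solve-∀

¬¬-twoActiveLevels⊎inactiveFrom : ∀ M → ¬ ¬ (TwoActiveLevels M ⊎ Σ ℕ (InactiveFrom M))
¬¬-twoActiveLevels⊎inactiveFrom M done = ¬¬-excluded-middle {A = TwoActiveLevels M} λ
  { (yes two) → done (inj₁ two)
  ; (no ¬two) → ¬¬-excluded-middle {A = Σ ℕ (Active M)} λ
      { (yes (r , active)) →
          done (inj₂ (suc r , λ k e r<k+e → ¬-not λ chosen → ¬two (above active r<k+e chosen)))
      ; (no ¬any) →
          done (inj₂ (0 , λ k e _ → ¬-not λ chosen → ¬any (k + e , k , e , refl , chosen))) } }
  where
  above : ∀ {r k e} → Active M r → suc r ≤ k + e → M (hook k e) ≡ true → TwoActiveLevels M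
  above {r} {k} {e} active r<k+e chosen with m≤n⇒∃[o]m+o≡n r<k+e
  ... | δ , r+δ≡ = r , δ , active , k , e , trans (sym r+δ≡) (sym (+-suc r δ)) , chosen

¬¬-improvement : ∀ {M} → NoConflicts M → ¬ ¬ Improvement M
¬¬-improvement {M} nc =
  ¬¬-map [ twoActiveLevels⇒improvement nc , inactiveFrom⇒improvement nc ∘ proj₂ ]
         (¬¬-twoActiveLevels⊎inactiveFrom M)

theorem1p2 : Σ Hypergraph3 λ H → ∀ M → ¬ StronglyMaximal H M
theorem1p2 = H₁ , λ M stronglyMaximal →
  ¬¬-improvement (isMatching⇒noConflicts M (proj₁ stronglyMaximal))
    (λ improvement → improvement⇒¬stronglyMaximal improvement stronglyMaximal)
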